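{- Let $a_1,\ldots,a_k$ be positive integers with $(a_1,\ldots,a_k)=1$. (a) If $b\ge\sum_{i=1}^{k-1}a_i\left(\frac{a_k}{(a_k,a_i)}-1\right)$, then there exist integers $x_1,\ldots,x_k\ge0$ with $a_1x_1+\cdots+a_kx_k=b$. (b) If $b\ge\sum_{i=1}^{k}\frac{a_ka_i}{(a_k,a_i)}$, then there exist integers $x_1,\ldots,x_k>0$ with $a_1x_1+\cdots+a_kx_k=b$.
   Context: $(b_1,\ldots,b_k)$ denotes the greatest common divisor. -}

module Defs where

open import Data.Nat using (ℕ; zero; suc; _+_; _*_; _∸_; _/_)
open import Data.Nat.GCD using (gcd)
open import Data.Fin using (Fin)
open import Data.Vec.Functional using (Vector; foldr)

gcdAll : ∀ {k} → Vector ℕ k → ℕ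
gcdAll = foldr gcd 0

sumF : ∀ {k} → Vector ℕ k → ℕ
sumF = foldr _+_ 0

-- truncated division: n ÷ d = n / d for d > 0 (only used with d > 0)
_÷_ : ℕ → ℕ → ℕ
n ÷ zero  = 0
n ÷ suc d = n / suc d

{-# OPTIONS --safe #-}
-- Induct on a₁, …, a_{k−1}, keeping n = a_k as a free multiple.  With
-- d = (a₂, …, a_{k−1}, n) we have (a₁, d) ∣ b, so a₁ x ≡ b (mod d) is solvable, and
-- since a₁ x mod d has period n / (n, a₁) in x there is a solution
-- 0 ≤ x₁ ≤ n / (n, a₁) − 1.  Then d ∣ b − a₁ x₁, which still exceeds the bound for
-- the remaining coefficients.  For (b), apply (a) to b − Σ aᵢ and add 1 to every
-- coefficient, using a_k aᵢ / (a_k, aᵢ) = aᵢ (a_k / (a_k, aᵢ) − 1) + aᵢ.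

module Submission where

open import Defs
open import Data.Nat using (ℕ; zero; suc; _+_; _*_; _∸_; _≤_; _<_; _/_; _%_; pred; s≤s; z≤n; NonZero; ≢-nonZero; ≢-nonZero⁻¹; >-nonZero)
open import Data.Nat.Properties
open import Data.Nat.DivMod
open import Data.Nat.Divisibility
open import Data.Nat.GCD
open import Data.Nat.Tactic.RingSolver using (solve-∀)
open import Algebra.Properties.CommutativeSemigroup +-commutativeSemigroup using (interchange)
open import Algebra.Properties.CommutativeSemigroup *-commutativeSemigroup using (x∙yz≈y∙xz)
open import Data.Fin using (Fin; inject₁; fromℕ; zero; suc)
open import Data.Vec.Functional using (Vector; foldr; _∷_; tail; init; last)
open import Data.Product using (_×_; Σ; _,_)
open import Data.Sum using (inj₁)
open import Relation.Binary.PropositionalEquality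

infix 7 _·_
_·_ : ∀ {k} → Vector ℕ k → Vector ℕ k → ℕ
a · x = sumF (λ i → a i * x i)

sumF-cong : ∀ {k} {f g : Vector ℕ k} → (∀ i → f i ≡ g i) → sumF f ≡ sumF g
sumF-cong {zero}  f≗g = refl
sumF-cong {suc k} f≗g = cong₂ _+_ (f≗g zero) (sumF-cong (λ i → f≗g (suc i)))

sumF-+ : ∀ {k} (f g : Vector ℕ k) → sumF (λ i → f i + g i) ≡ sumF f + sumF g
sumF-+ {zero}  f g = refl
sumF-+ {suc k} f g = begin
  f zero + g zero + sumF (λ i → tail f i + tail g i)
    ≡⟨ cong (f zero + g zero +_) (sumF-+ (tail f) (tail g)) ⟩
  f zero + g zero + (sumF (tail f) + sumF (tail g))
    ≡⟨ interchange (f zero) (g zero) (sumF (tail f)) (sumF (tail g)) ⟩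
  f zero + sumF (tail f) + (g zero + sumF (tail g)) ∎
  where open ≡-Reasoning

sumF-init-last : ∀ {m} (f : Vector ℕ (suc m)) → sumF f ≡ sumF (init f) + last f
sumF-init-last {zero}  f = +-identityʳ (f zero)
sumF-init-last {suc m} f =
  trans (cong (f zero +_) (sumF-init-last (tail f))) (sym (+-assoc (f zero) _ _))

gcdAll-init-last : ∀ {m} (a : Vector ℕ (suc m)) → gcdAll a ≡ foldr gcd (last a) (init a)
gcdAll-init-last {zero}  a = gcd-identityʳ (a zero)
gcdAll-init-last {suc m} a = cong (gcd (a zero)) (gcdAll-init-last (tail a))

foldr-gcd∣seed : ∀ {m} n (a : Vector ℕ m) → foldr gcd n a ∣ n
foldr-gcd∣seed {zero}  n a = ∣-refl
foldr-gcd∣seed {suc m} n a = ∣-trans (gcd[m,n]∣n (a zero) _) (foldr-gcd∣seed n (tail a))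

infixl 5 _∷ʳ_
_∷ʳ_ : ∀ {m} → Vector ℕ m → ℕ → Vector ℕ (suc m)
_∷ʳ_ {zero}  x y _       = y
_∷ʳ_ {suc m} x y zero    = x zero
_∷ʳ_ {suc m} x y (suc i) = (tail x ∷ʳ y) i

init-∷ʳ : ∀ {m} (x : Vector ℕ m) y i → init (x ∷ʳ y) i ≡ x i
init-∷ʳ {suc m} x y zero    = refl
init-∷ʳ {suc m} x y (suc i) = init-∷ʳ (tail x) y i

last-∷ʳ : ∀ {m} (x : Vector ℕ m) y → last (x ∷ʳ y) ≡ y
last-∷ʳ {zero}  x y = refl
last-∷ʳ {suc m} x y = last-∷ʳ (tail x) y

÷≡/ : ∀ m n .{{_ : NonZero n}} → m ÷ n ≡ m / n
÷≡/ m (suc n) = refl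

divisor-nonZero : ∀ {m n} .{{_ : NonZero n}} → m ∣ n → NonZero m
divisor-nonZero {n = n} m∣n = ≢-nonZero λ { refl → ≢-nonZero⁻¹ n (0∣⇒≡0 m∣n) }

%-≡⇒∣∸ : ∀ m n d .{{_ : NonZero d}} → m % d ≡ n % d → d ∣ n ∸ m
%-≡⇒∣∸ m n d m≡n = divides (n / d ∸ m / d) (begin
  n ∸ m                                       ≡⟨ cong₂ _∸_ (m≡m%n+[m/n]*n n d) (m≡m%n+[m/n]*n m d) ⟩
  (n % d + n / d * d) ∸ (m % d + m / d * d)   ≡⟨ cong (λ r → (n % d + n / d * d) ∸ (r + m / d * d)) m≡n ⟩
  (n % d + n / d * d) ∸ (n % d + m / d * d)   ≡⟨ [m+n]∸[m+o]≡n∸o (n % d) _ _ ⟩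
  n / d * d ∸ m / d * d                       ≡⟨ *-distribʳ-∸ d (n / d) (m / d) ⟨
  (n / d ∸ m / d) * d                         ∎)
  where open ≡-Reasoning

%-≡-*ˡ : ∀ c {m n d} .{{_ : NonZero d}} → m % d ≡ n % d → (c * m) % d ≡ (c * n) % d
%-≡-*ˡ c {m} {n} {d} m≡n = begin
  (c * m) % d             ≡⟨ %-distribˡ-* c m d ⟩
  (c % d * (m % d)) % d   ≡⟨ cong (λ r → (c % d * r) % d) m≡n ⟩
  (c % d * (n % d)) % d   ≡⟨ %-distribˡ-* c n d ⟨
  (c * n) % d             ∎
  where open ≡-Reasoning

bézout-% : ∀ a d .{{_ : NonZero d}} → Σ ℕ λ x → (a * x) % d ≡ gcd a d % d
bézout-% a d@(suc r) with Bézout.identity (gcd-GCD a d)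
... | Bézout.Identity.+- x y g+yd≡xa = x , (begin
  (a * x) % d        ≡⟨ cong (_% d) (trans (*-comm a x) (sym g+yd≡xa)) ⟩
  (g + y * d) % d    ≡⟨ [m+kn]%n≡m%n g y d ⟩
  g % d              ∎)
  where open ≡-Reasoning; g = gcd a d
-- Here x a ≡ −g (mod d), so multiplying x by d − 1 = r flips the sign.
... | Bézout.Identity.-+ x y g+xa≡yd = x * r , (begin
  (a * (x * r)) % d              ≡⟨ [m+kn]%n≡m%n (a * (x * r)) g d ⟨
  (a * (x * r) + g * d) % d      ≡⟨ cong (_% d) (regroup a x r g) ⟩
  (g + r * (g + x * a)) % d      ≡⟨ cong (λ t → (g + r * t) % d) g+xa≡yd ⟩
  (g + r * (y * d)) % d          ≡⟨ cong (λ t → (g + t) % d) (*-assoc r y d) ⟨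
  (g + r * y * d) % d            ≡⟨ [m+kn]%n≡m%n g (r * y) d ⟩
  g % d                          ∎)
  where
    open ≡-Reasoning
    g = gcd a d
    regroup : ∀ a x r g → a * (x * r) + g * suc r ≡ g + r * (g + x * a)
    regroup = solve-∀

linear-congruence : ∀ a b d .{{_ : NonZero d}} → gcd a d ∣ b → Σ ℕ λ x → (a * x) % d ≡ b % d
linear-congruence a b d (divides c refl) with bézout-% a d
... | x , ax≡g = c * x , trans (cong (_% d) (x∙yz≈y∙xz a c x)) (%-≡-*ˡ c ax≡g)

%-periodic : ∀ a x q d .{{_ : NonZero q}} .{{_ : NonZero d}} →
  d ∣ a * q → (a * (x % q)) % d ≡ (a * x) % d
%-periodic a x q d d∣aq = begin
  (a * (x % q)) % d                   ≡⟨ %-remove-+ʳ (a * (x % q)) (∣-trans d∣aq (∣m⇒∣m*n (x / q) ∣-refl)) ⟨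
  (a * (x % q) + a * q * (x / q)) % d ≡⟨ cong (_% d) (expand a (x % q) (x / q) q) ⟩
  (a * (x % q + x / q * q)) % d       ≡⟨ cong (λ t → (a * t) % d) (m≡m%n+[m/n]*n x q) ⟨
  (a * x) % d                         ∎
  where
    open ≡-Reasoning
    expand : ∀ a r s q → a * r + a * q * s ≡ a * (r + s * q)
    expand = solve-∀

n∣m*[n/gcd[n,m]] : ∀ n m .{{_ : NonZero (gcd n m)}} → n ∣ m * (n / gcd n m)
n∣m*[n/gcd[n,m]] n m = divides (m / gcd n m) (begin
  m * (n / gcd n m)   ≡⟨ *-/-assoc m (gcd[m,n]∣m n m) ⟨
  m * n / gcd n m     ≡⟨ cong (_/ gcd n m) (*-comm m n) ⟩
  n * m / gcd n m     ≡⟨ *-/-assoc n (gcd[m,n]∣n n m) ⟩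
  n * (m / gcd n m)   ≡⟨ *-comm n _ ⟩
  m / gcd n m * n     ∎)
  where open ≡-Reasoning

pred[n/d]≡n÷d∸1 : ∀ n d .{{_ : NonZero d}} → pred (n / d) ≡ n ÷ d ∸ 1
pred[n/d]≡n÷d∸1 n d = trans (pred[m∸n]≡m∸[1+n] (n / d) 0) (cong (_∸ 1) (sym (÷≡/ n d)))

gcd-nonZeroˡ : ∀ n m .{{_ : NonZero n}} → NonZero (gcd n m)
gcd-nonZeroˡ n m = ≢-nonZero (gcd[m,n]≢0 n m (inj₁ (≢-nonZero⁻¹ n)))

*-÷-gcd-split : ∀ n c .{{_ : NonZero n}} → (n * c) ÷ gcd n c ≡ c * ((n ÷ gcd n c) ∸ 1) + c
*-÷-gcd-split n c = begin
  (n * c) ÷ g         ≡⟨ ÷≡/ (n * c) g ⟩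
  n * c / g           ≡⟨ cong (_/ g) (*-comm n c) ⟩
  c * n / g           ≡⟨ *-/-assoc c (gcd[m,n]∣m n c) ⟩
  c * q               ≡⟨ cong (c *_) (suc-pred q) ⟨
  c * suc (pred q)    ≡⟨ *-suc c (pred q) ⟩
  c + c * pred q      ≡⟨ +-comm c _ ⟩
  c * pred q + c      ≡⟨ cong (λ t → c * t + c) (pred[n/d]≡n÷d∸1 n g) ⟩
  c * (n ÷ g ∸ 1) + c ∎
  where
    open ≡-Reasoning
    g = gcd n c
    instance
      _ : NonZero g
      _ = gcd-nonZeroˡ n c
    q = n / g
    instance
      _ : NonZero q
      _ = ≢-nonZero (m/gcd[m,n]≢0 n c)

coefficient-below-period : ∀ n a b d .{{_ : NonZero n}} → d ∣ n → gcd a d ∣ b →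
  Σ ℕ λ x → x ≤ n ÷ gcd n a ∸ 1 × d ∣ b ∸ a * x
coefficient-below-period n a b d d∣n g∣b with linear-congruence a b d {{divisor-nonZero d∣n}} g∣b
... | x , ax≡b = x % q , x%q≤ , %-≡⇒∣∸ (a * (x % q)) b d (trans periodic ax≡b)
  where
    instance
      _ : NonZero d
      _ = divisor-nonZero d∣n
      _ : NonZero (gcd n a)
      _ = gcd-nonZeroˡ n a
    q = n / gcd n a
    instance
      _ : NonZero q
      _ = ≢-nonZero (m/gcd[m,n]≢0 n a)
    x%q≤ : x % q ≤ n ÷ gcd n a ∸ 1
    x%q≤ = ≤-trans (<⇒≤pred (m%n<n x q)) (≤-reflexive (pred[n/d]≡n÷d∸1 n (gcd n a)))
    periodic : (a * (x % q)) % d ≡ (a * x) % d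
    periodic = %-periodic a x q d (∣-trans d∣n (n∣m*[n/gcd[n,m]] n a))

cons-representation : ∀ {m} n (a : Vector ℕ (suc m)) b x₀ → a zero * x₀ ≤ b →
  (Σ (Vector ℕ m) λ x → Σ ℕ λ y → tail a · x + n * y ≡ b ∸ a zero * x₀) →
  Σ (Vector ℕ (suc m)) λ x → Σ ℕ λ y → a · x + n * y ≡ b
cons-representation n a b x₀ a₀x₀≤b (x , y , eq) = x₀ ∷ x , y , (begin
  a zero * x₀ + tail a · x + n * y     ≡⟨ +-assoc (a zero * x₀) _ _ ⟩
  a zero * x₀ + (tail a · x + n * y)   ≡⟨ cong (a zero * x₀ +_) eq ⟩
  a zero * x₀ + (b ∸ a zero * x₀)      ≡⟨ m+[n∸m]≡n a₀x₀≤b ⟩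
  b                                    ∎)
  where open ≡-Reasoning

representation-with-multiple : ∀ {m} n .{{_ : NonZero n}} (a : Vector ℕ m) b →
  foldr gcd n a ∣ b → sumF (λ i → a i * ((n ÷ gcd n (a i)) ∸ 1)) ≤ b →
  Σ (Vector ℕ m) λ x → Σ ℕ λ y → a · x + n * y ≡ b
representation-with-multiple {zero} n a b (divides y refl) _ = (λ ()) , y , *-comm n y
representation-with-multiple {suc m} n a b g∣b bound =
  extend (coefficient-below-period n (a zero) b d (foldr-gcd∣seed n (tail a)) g∣b)
  where
    d = foldr gcd n (tail a)
    S = sumF (λ i → tail a i * ((n ÷ gcd n (tail a i)) ∸ 1))
    extend : (Σ ℕ λ x₀ → x₀ ≤ n ÷ gcd n (a zero) ∸ 1 × d ∣ b ∸ a zero * x₀) →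
      Σ (Vector ℕ (suc m)) λ x → Σ ℕ λ y → a · x + n * y ≡ b
    extend (x₀ , x₀≤ , d∣rest) = cons-representation n a b x₀ a₀x₀≤b
        (representation-with-multiple n (tail a) (b ∸ a zero * x₀) d∣rest restBound)
      where
        a₀x₀≤ : a zero * x₀ ≤ a zero * ((n ÷ gcd n (a zero)) ∸ 1)
        a₀x₀≤ = *-monoʳ-≤ (a zero) x₀≤
        a₀x₀≤b : a zero * x₀ ≤ b
        a₀x₀≤b = ≤-trans a₀x₀≤ (≤-trans (m≤m+n _ S) bound)
        restBound : S ≤ b ∸ a zero * x₀
        restBound = m+n≤o⇒m≤o∸n S (≤-trans (≤-reflexive (+-comm S _)) (≤-trans (+-monoˡ-≤ S a₀x₀≤) bound))

representation : ∀ {m} (a : Vector ℕ (suc m)) .{{_ : NonZero (last a)}} b → gcdAll a ∣ b →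
  sumF (λ i → init a i * ((last a ÷ gcd (last a) (init a i)) ∸ 1)) ≤ b →
  Σ (Vector ℕ (suc m)) λ x → a · x ≡ b
representation a b g∣b bound = append-last
  (representation-with-multiple (last a) (init a) b (subst (_∣ b) (gcdAll-init-last a) g∣b) bound)
  where
    append-last : (Σ _ λ x → Σ ℕ λ y → init a · x + last a * y ≡ b) → Σ _ λ x → a · x ≡ b
    append-last (x , y , eq) = x ∷ʳ y , (begin
      a · (x ∷ʳ y)                                      ≡⟨ sumF-init-last (λ i → a i * (x ∷ʳ y) i) ⟩
      init a · init (x ∷ʳ y) + last a * last (x ∷ʳ y)   ≡⟨ cong₂ _+_ (sumF-cong λ i → cong (init a i *_) (init-∷ʳ x y i))
                                                                      (cong (last a *_) (last-∷ʳ x y)) ⟩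
      init a · x + last a * y                           ≡⟨ eq ⟩
      b                                                 ∎)
      where open ≡-Reasoning

positive-representation : ∀ {k} (a : Vector ℕ k) b → sumF a ≤ b →
  (Σ (Vector ℕ k) λ x → a · x ≡ b ∸ sumF a) →
  Σ (Vector ℕ k) λ x → (∀ i → 0 < x i) × a · x ≡ b
positive-representation a b Σa≤b (x , eq) = (λ i → suc (x i)) , (λ i → s≤s z≤n) , (begin
  a · (λ i → suc (x i))              ≡⟨ sumF-cong (λ i → *-suc (a i) (x i)) ⟩
  sumF (λ i → a i + a i * x i)       ≡⟨ sumF-+ a (λ i → a i * x i) ⟩
  sumF a + a · x                     ≡⟨ cong (sumF a +_) eq ⟩
  sumF a + (b ∸ sumF a)              ≡⟨ m+[n∸m]≡n Σa≤b ⟩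
  b                                  ∎)
  where open ≡-Reasoning

mainTheorem8 : (m : ℕ) (a : Vector ℕ (suc m)) →
    (∀ i → 0 < a i) → gcdAll a ≡ 1 →
    ((b : ℕ) →
      sumF (λ (i : Fin m) → a (inject₁ i) * ((a (fromℕ m) ÷ gcd (a (fromℕ m)) (a (inject₁ i))) ∸ 1)) ≤ b →
      Σ (Vector ℕ (suc m)) λ x → sumF (λ i → a i * x i) ≡ b)
    ×
    ((b : ℕ) →
      sumF (λ i → (a (fromℕ m) * a i) ÷ gcd (a (fromℕ m)) (a i)) ≤ b →
      Σ (Vector ℕ (suc m)) λ x → (∀ i → 0 < x i) × sumF (λ i → a i * x i) ≡ b)
mainTheorem8 m a pos gcd≡1 = partA , partB
  where
    n = last a
    instance
      _ : NonZero n
      _ = >-nonZero (pos (fromℕ m))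
    D : Vector ℕ (suc m)
    D i = a i * ((n ÷ gcd n (a i)) ∸ 1)
    partA : (b : ℕ) → sumF (init D) ≤ b → Σ (Vector ℕ (suc m)) λ x → a · x ≡ b
    partA b = representation a b (subst (_∣ b) (sym gcd≡1) (1∣ b))
    partB : (b : ℕ) → sumF (λ i → (n * a i) ÷ gcd n (a i)) ≤ b →
      Σ (Vector ℕ (suc m)) λ x → (∀ i → 0 < x i) × a · x ≡ b
    partB b bound = positive-representation a b (≤-trans (m≤n+m _ (sumF D)) D+a≤b)
      (partA (b ∸ sumF a) (m+n≤o⇒m≤o∸n _ (≤-trans (+-monoˡ-≤ (sumF a) initD≤D) D+a≤b)))
      where
        D+a≤b : sumF D + sumF a ≤ b
        D+a≤b = subst (_≤ b) (trans (sumF-cong λ i → *-÷-gcd-split n (a i)) (sumF-+ D a)) bound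
        initD≤D : sumF (init D) ≤ sumF D
        initD≤D = ≤-trans (m≤m+n _ (last D)) (≤-reflexive (sym (sumF-init-last D)))
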